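{- Let $G=(V,E)$ be a finite simple graph with a splitting $(G^1,G^2,\{v\})$ at an articulation $v\in V$. Then \begin{align*} D(G,x) ={}& x\,D(G/v,x) + D(G^1-v,x)\,D(G^2-v,x) + x\,D(G^1-N_{G^1}[v],x)\,D(G^2-N_{G^2}[v],x)\\ &-\frac{1}{1+x}\Big[\big(xD(G^1/v,x)+D(G^1-v,x)+xD(G^1-N_{G^1}[v],x)-D(G^1,x)\big)\\ &\qquad\cdot\big(xD(G^2/v,x)+D(G^2-v,x)+xD(G^2-N_{G^2}[v],x)-D(G^2,x)\big)\Big]. \end{align*}
   Context: The domination polynomial of a finite simple graph $H=(V,E)$ is $D(H,x)=\sum_{W\subseteq V,\ N_H[W]=V}x^{|W|}$, where $N_H[W]$ is the closed neighborhood of $W$; the graph with no vertices has $D=1$. A splitting $(G^1,G^2,X)$ of $G$ consists of subgraphs $G^i=(V^i,E^i)$ with $V=V^1\cup V^2$, $X=V^1\cap V^2$, $E=E^1\cup E^2$ and $E^1\cap E^2=\emptyset$; when $X=\{v\}$, $v$ is an articulation. Graph operations: - $H-v$ deletes $v$. - $H/v$ deletes $v$ and adds edges between all pairs of non-adjacent neighbors of $v$ in $H$. - $H-N_H[v]$ deletes the closed neighborhood of $v$ in $H$. -}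

module Defs where

open import Data.Nat using (ℕ; zero; suc)
open import Data.Bool using (Bool; true; false; _∧_; _∨_; not; if_then_else_)
open import Data.Fin using (Fin; _≟_)
open import Data.Fin.Subset using (Subset; ∣_∣)
open import Data.Vec using (Vec; []; _∷_; lookup)
open import Data.List using (List; []; _∷_; map; allFin; foldr; _++_; filterᵇ)
open import Data.Rational using (ℚ; 0ℚ; 1ℚ; _+_; _*_)
open import Relation.Nullary using (yes; no)
open import Relation.Nullary.Decidable using (⌊_⌋)
open import Relation.Binary.PropositionalEquality using (_≡_; refl) renaming (sym to sym≡)
open import Relation.Nullary using (contradiction)
open import Data.Bool.ListAction using (all; any)
open import Data.Bool.Properties using (∨-comm; ∧-comm)

_==_ : ∀ {n} → Fin n → Fin n → Bool
u == w = ⌊ u ≟ w ⌋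

==-sym : ∀ {n} (u w : Fin n) → (u == w) ≡ (w == u)
==-sym u w with u ≟ w | w ≟ u
... | yes _ | yes _ = refl
... | no _ | no _ = refl
... | yes p | no ¬q = contradiction (sym≡ p) ¬q
... | no ¬p | yes q = contradiction (sym≡ q) ¬p

==-refl : ∀ {n} (u : Fin n) → (u == u) ≡ true
==-refl u with u ≟ u
... | yes _ = refl
... | no ¬p = contradiction refl ¬p

-- A finite simple graph whose vertex set is a subset of the universe Fin n.
-- 'adj' is a symmetric irreflexive relation on the universe; the actual edge
-- set of the graph consists of the pairs {u,w} with u, w ∈ V and adj u w
-- (see 'E' below), so adjacencies touching vertices outside V are ignored.
record Graph (n : ℕ) : Set where
  field
    V     : Fin n → Bool
    adj   : Fin n → Fin n → Bool
    sym   : ∀ u w → adj u w ≡ adj w u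
    irr   : ∀ u → adj u u ≡ false
open Graph public

E : ∀ {n} → Graph n → Fin n → Fin n → Bool
E H u w = V H u ∧ V H w ∧ adj H u w

delete : ∀ {n} → Graph n → Fin n → Graph n
delete H v = record { V = λ u → V H u ∧ not (u == v) ; adj = adj H ; sym = sym H ; irr = irr H }

deleteN : ∀ {n} → Graph n → Fin n → Graph n
deleteN H v = record
  { V = λ u → V H u ∧ not ((u == v) ∨ E H v u) ; adj = adj H ; sym = sym H ; irr = irr H }

-- H / v : delete v and join all pairs of (distinct) neighbours of v in H
contractAdj : ∀ {n} → Graph n → Fin n → Fin n → Fin n → Bool
contractAdj H v u w = adj H u w ∨ (not (u == w) ∧ (E H v u ∧ E H v w))

private
  contract-sym : ∀ {n} (H : Graph n) v u w → contractAdj H v u w ≡ contractAdj H v w u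
  contract-sym H v u w rewrite sym H u w | ==-sym u w | ∧-comm (E H v u) (E H v w) = refl

  contract-irr : ∀ {n} (H : Graph n) v u → contractAdj H v u u ≡ false
  contract-irr H v u rewrite irr H u | ==-refl u = refl

contract : ∀ {n} → Graph n → Fin n → Graph n
contract H v = record
  { V = λ u → V H u ∧ not (u == v) ; adj = contractAdj H v
  ; sym = contract-sym H v ; irr = contract-irr H v }

allSubsets : (n : ℕ) → List (Subset n)
allSubsets zero = [] ∷ []
allSubsets (suc n) = map (true ∷_) (allSubsets n) ++ map (false ∷_) (allSubsets n)

within : ∀ {n} → Graph n → Subset n → Bool
within {n} H W = all (λ u → not (lookup W u) ∨ V H u) (allFin n)

dominating : ∀ {n} → Graph n → Subset n → Bool
dominating {n} H W =
  all (λ u → not (V H u) ∨ (lookup W u ∨ any (λ w → lookup W w ∧ E H w u) (allFin n))) (allFin n)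

isDomSet : ∀ {n} → Graph n → Subset n → Bool
isDomSet H W = within H W ∧ dominating H W

_^_ : ℚ → ℕ → ℚ
x ^ zero = 1ℚ
x ^ suc k = x * (x ^ k)

sumℚ : List ℚ → ℚ
sumℚ = foldr _+_ 0ℚ

D : ∀ {n} → Graph n → ℚ → ℚ
D {n} H x = sumℚ (map (λ W → x ^ ∣ W ∣) (filterᵇ (isDomSet H) (allSubsets n)))

record IsSplitting {n} (G G¹ G² : Graph n) (v : Fin n) : Set where
  field
    vert-union : ∀ u → V G u ≡ (V G¹ u ∨ V G² u)
    vert-inter : ∀ u → (V G¹ u ∧ V G² u) ≡ (u == v)
    edge-union : ∀ u w → E G u w ≡ (E G¹ u w ∨ E G² u w)
    edge-disj  : ∀ u w → (E G¹ u w ∧ E G² u w) ≡ false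

-- The proof rests on a recurrence valid at every vertex v of a graph H,
--     D(H) + (1 + x) p_v(H) = x D(H / v) + D(H − v) + x D(H − N[v]),
-- where p_v(H) is the generating polynomial of the sets W ⊆ V(H) ∖ N[v] dominating H − v.  It is
-- proved by pairing every W ∌ v with W ∪ {v}: all domination conditions at W and W ∪ {v} are
-- expressed through three Booleans (module NormalForms), and each pair then satisfies a ring
-- identity.  The second ingredient is that domination polynomials, also with candidate sets
-- restricted to a subset, are multiplicative over disjoint unions.  At an articulation v the
-- graphs G − v and G − N[v] are disjoint unions of the corresponding graphs for G¹ and G², so
-- D(G − v), D(G − N[v]) and p_v(G) factor; the recurrences at G, G¹ and G² then give the theorem.
module Submission where

open import Defs renaming (sym to adj-sym)
open import Data.Nat using (zero; suc) renaming (_+_ to _+ℕ_)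
open import Data.Nat.Properties using (+-suc)
open import Data.Bool using (Bool; true; false; _∧_; _∨_; not; if_then_else_; T)
open import Data.Bool.Properties
  using (∧-assoc; ∧-comm; ∨-comm; ∧-zeroʳ; ∨-identityʳ; ∧-identityʳ; ∧-distribˡ-∨; ∧-distribʳ-∨; ∧-inverseʳ;
         ∧-commutativeMonoid; ∨-commutativeMonoid)
open import Data.Bool.ListAction using (all; any)
open import Data.Bool.Solver using (module ∨-∧-Solver)
open ∨-∧-Solver using (_:+_; _:*_; _:=_) renaming (solve to solve-∨∧)
open import Algebra.Bundles using (CommutativeMonoid)
import Algebra.Properties.CommutativeSemigroup as CommSemigroupProperties
open import Data.Fin using (Fin; zero; suc; _≟_)
open import Data.Fin.Subset using (Subset; ∣_∣; _∩_)
open import Data.Vec using ([]; _∷_; lookup)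
import Data.Vec as Vec
open import Data.Vec.Properties using (lookup-zipWith; lookup∘tabulate)
open import Data.Empty using (⊥-elim)
open import Data.List using (List; []; _∷_; map; _++_; filterᵇ; tabulate; allFin)
open import Data.Rational using (ℚ; 0ℚ; 1ℚ; _+_; _-_; _*_; 1/_; NonZero)
open import Data.Rational.Properties
  using (+-*-commutativeRing; +-identityˡ; +-assoc; *-distribˡ-+; *-zeroˡ; *-zeroʳ; *-identityˡ; *-assoc; *-inverseˡ)
  renaming (_≟_ to _ℚ≟_)
open import Data.Maybe using (Maybe; just; nothing)
open import Function using (_∘_)
open import Relation.Binary.PropositionalEquality
open import Relation.Nullary using (yes; no)
open import Tactic.RingSolver using (solve-∀)
open import Tactic.RingSolver.Core.AlmostCommutativeRing using (AlmostCommutativeRing; fromCommutativeRing)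

-- ℚ as a ring for the reflective ring solver (which needs to recognise the literal 0ℚ).
ℚ-ring : AlmostCommutativeRing _ _
ℚ-ring = fromCommutativeRing +-*-commutativeRing is-zero
  where
  is-zero : ∀ x → Maybe (0ℚ ≡ x)
  is-zero x with 0ℚ ℚ≟ x
  ... | yes p = just p
  ... | no  _ = nothing

sumOf : ∀ {a} {A : Set a} → (A → ℚ) → List A → ℚ
sumOf f xs = sumℚ (map f xs)

sumOf-cong : ∀ {a} {A : Set a} {f g : A → ℚ} (xs : List A) → (∀ x → f x ≡ g x) → sumOf f xs ≡ sumOf g xs
sumOf-cong []       f≡g = refl
sumOf-cong (x ∷ xs) f≡g = cong₂ _+_ (f≡g x) (sumOf-cong xs f≡g)

sumOf-+ : ∀ {a} {A : Set a} (f g : A → ℚ) (xs : List A) →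
  sumOf (λ x → f x + g x) xs ≡ sumOf f xs + sumOf g xs
sumOf-+ f g []       = refl
sumOf-+ f g (x ∷ xs) rewrite sumOf-+ f g xs = interchange (f x) (g x) (sumOf f xs) (sumOf g xs)
  where
  interchange : ∀ a b c d → (a + b) + (c + d) ≡ (a + c) + (b + d)
  interchange = solve-∀ ℚ-ring

sumOf-* : ∀ {a} {A : Set a} (c : ℚ) (f : A → ℚ) (xs : List A) → sumOf (λ x → c * f x) xs ≡ c * sumOf f xs
sumOf-* c f []       = sym (*-zeroʳ c)
sumOf-* c f (x ∷ xs) rewrite sumOf-* c f xs = sym (*-distribˡ-+ c (f x) (sumOf f xs))

sumOf-0 : ∀ {a} {A : Set a} (xs : List A) → sumOf (λ _ → 0ℚ) xs ≡ 0ℚ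
sumOf-0 []       = refl
sumOf-0 (x ∷ xs) rewrite sumOf-0 xs = refl

sumOf-++ : ∀ {a} {A : Set a} (f : A → ℚ) (xs ys : List A) → sumOf f (xs ++ ys) ≡ sumOf f xs + sumOf f ys
sumOf-++ f []       ys = sym (+-identityˡ _)
sumOf-++ f (x ∷ xs) ys rewrite sumOf-++ f xs ys = sym (+-assoc (f x) (sumOf f xs) (sumOf f ys))

sumOf-map : ∀ {a b} {A : Set a} {B : Set b} (f : B → ℚ) (g : A → B) (xs : List A) →
  sumOf f (map g xs) ≡ sumOf (f ∘ g) xs
sumOf-map f g []       = refl
sumOf-map f g (x ∷ xs) rewrite sumOf-map f g xs = refl

ind : Bool → ℚ → ℚ
ind b y = if b then y else 0ℚ

ind-∧ : ∀ a b y → ind (a ∧ b) y ≡ ind a (ind b y)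
ind-∧ true  b y = refl
ind-∧ false b y = refl

ind-∧-* : ∀ a b y z → ind (a ∧ b) (y * z) ≡ ind a y * ind b z
ind-∧-* true  true  y z = refl
ind-∧-* true  false y z = sym (*-zeroʳ y)
ind-∧-* false b     y z = sym (*-zeroˡ (ind b z))

ind-scale : ∀ b (x y : ℚ) → ind b (x * y) ≡ x * ind b y
ind-scale true  x y = refl
ind-scale false x y = sym (*-zeroʳ x)

ind-guard : ∀ a {y z} → (T a → y ≡ z) → ind a y ≡ ind a z
ind-guard true  y≡z = y≡z _
ind-guard false y≡z = refl

sumOf-filter : ∀ {a} {A : Set a} (f : A → ℚ) (p : A → Bool) (xs : List A) →
  sumOf f (filterᵇ p xs) ≡ sumOf (λ x → ind (p x) (f x)) xs
sumOf-filter f p []       = refl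
sumOf-filter f p (x ∷ xs) with p x
... | true  = cong (f x +_) (sumOf-filter f p xs)
... | false = trans (sumOf-filter f p xs) (sym (+-identityˡ _))

∑ : ∀ {n} → (Subset n → ℚ) → ℚ
∑ {n} f = sumOf f (allSubsets n)

∑-cong : ∀ {n} {f g : Subset n → ℚ} → (∀ W → f W ≡ g W) → ∑ f ≡ ∑ g
∑-cong {n} = sumOf-cong (allSubsets n)

∑-+ : ∀ {n} (f g : Subset n → ℚ) → ∑ (λ W → f W + g W) ≡ ∑ f + ∑ g
∑-+ {n} f g = sumOf-+ f g (allSubsets n)

∑-* : ∀ {n} (c : ℚ) (f : Subset n → ℚ) → ∑ (λ W → c * f W) ≡ c * ∑ f
∑-* {n} c f = sumOf-* c f (allSubsets n)

∑-suc : ∀ {n} (f : Subset (suc n) → ℚ) → ∑ f ≡ ∑ (λ W → f (true ∷ W)) + ∑ (λ W → f (false ∷ W))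
∑-suc {n} f = trans (sumOf-++ f (map (true ∷_) (allSubsets n)) _)
  (cong₂ _+_ (sumOf-map f _ (allSubsets n)) (sumOf-map f _ (allSubsets n)))

∑-ind : ∀ {n} (b : Bool) (h : Subset n → ℚ) → ∑ (λ W → ind b (h W)) ≡ ind b (∑ h)
∑-ind     true  h = refl
∑-ind {n} false h = sumOf-0 (allSubsets n)

insert : ∀ {n} → Fin n → Subset n → Subset n
insert zero    (_ ∷ W) = true ∷ W
insert (suc v) (b ∷ W) = b ∷ insert v W

==-suc : ∀ {n} (u v : Fin n) → (suc u == suc v) ≡ (u == v)
==-suc u v with u ≟ v
... | yes _ = refl
... | no  _ = refl

lookup-insert : ∀ {n} (v u : Fin n) (W : Subset n) → lookup (insert v W) u ≡ (u == v) ∨ lookup W u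
lookup-insert zero    zero    (_ ∷ W) = refl
lookup-insert zero    (suc u) (_ ∷ W) = refl
lookup-insert (suc v) zero    (_ ∷ W) = refl
lookup-insert (suc v) (suc u) (_ ∷ W) =
  trans (lookup-insert v u W) (cong (_∨ lookup W u) (sym (==-suc u v)))

∣insert∣ : ∀ {n} (v : Fin n) (W : Subset n) → lookup W v ≡ false → ∣ insert v W ∣ ≡ suc ∣ W ∣
∣insert∣ zero    (false ∷ W) v∉W = refl
∣insert∣ (suc v) (true  ∷ W) v∉W = cong suc (∣insert∣ v W v∉W)
∣insert∣ (suc v) (false ∷ W) v∉W = ∣insert∣ v W v∉W

∑-pair : ∀ {n} (v : Fin n) (f : Subset n → ℚ) →
  ∑ f ≡ ∑ (λ W → if lookup W v then 0ℚ else f W + f (insert v W))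
∑-pair {suc n} zero f = begin
    ∑ f                                                          ≡⟨ ∑-suc f ⟩
    ∑ (λ W → f (true ∷ W)) + ∑ (λ W → f (false ∷ W))
      ≡⟨ swap-in-0 (∑ (λ W → f (true ∷ W))) (∑ (λ W → f (false ∷ W))) ⟩
    0ℚ + (∑ (λ W → f (false ∷ W)) + ∑ (λ W → f (true ∷ W)))
      ≡⟨ cong₂ _+_ (sym (sumOf-0 (allSubsets n))) (sym (∑-+ (λ W → f (false ∷ W)) (λ W → f (true ∷ W)))) ⟩
    ∑ (λ (W : Subset n) → 0ℚ) + ∑ (λ W → f (false ∷ W) + f (true ∷ W))
      ≡⟨ sym (∑-suc (λ W → if lookup W zero then 0ℚ else f W + f (insert zero W))) ⟩
    ∑ (λ W → if lookup W zero then 0ℚ else f W + f (insert zero W))  ∎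
  where
  open ≡-Reasoning
  swap-in-0 : ∀ a b → a + b ≡ 0ℚ + (b + a)
  swap-in-0 = solve-∀ ℚ-ring
∑-pair {suc n} (suc v) f = begin
    ∑ f                                                 ≡⟨ ∑-suc f ⟩
    ∑ (λ W → f (true ∷ W)) + ∑ (λ W → f (false ∷ W))   ≡⟨ cong₂ _+_ (∑-pair v _) (∑-pair v _) ⟩
    _                                                   ≡⟨ sym (∑-suc g) ⟩
    ∑ g                                                 ∎
  where
  open ≡-Reasoning
  g : Subset (suc n) → ℚ
  g W = if lookup W (suc v) then 0ℚ else f W + f (insert (suc v) W)

module ∧-Props = CommSemigroupProperties (CommutativeMonoid.commutativeSemigroup ∧-commutativeMonoid)
module ∨-Props = CommSemigroupProperties (CommutativeMonoid.commutativeSemigroup ∨-commutativeMonoid)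

allᶠ : ∀ {n} → (Fin n → Bool) → Bool
allᶠ {zero}  p = true
allᶠ {suc n} p = p zero ∧ allᶠ (p ∘ suc)

anyᶠ : ∀ {n} → (Fin n → Bool) → Bool
anyᶠ {zero}  p = false
anyᶠ {suc n} p = p zero ∨ anyᶠ (p ∘ suc)

all-tabulate : ∀ {a} {A : Set a} {n} (p : A → Bool) (g : Fin n → A) → all p (tabulate g) ≡ allᶠ (p ∘ g)
all-tabulate {n = zero}  p g = refl
all-tabulate {n = suc n} p g = cong (p (g zero) ∧_) (all-tabulate p (g ∘ suc))

any-tabulate : ∀ {a} {A : Set a} {n} (p : A → Bool) (g : Fin n → A) → any p (tabulate g) ≡ anyᶠ (p ∘ g)
any-tabulate {n = zero}  p g = refl
any-tabulate {n = suc n} p g = cong (p (g zero) ∨_) (any-tabulate p (g ∘ suc))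

allᶠ-cong : ∀ {n} {p q : Fin n → Bool} → (∀ u → p u ≡ q u) → allᶠ p ≡ allᶠ q
allᶠ-cong {zero}  p≡q = refl
allᶠ-cong {suc n} p≡q = cong₂ _∧_ (p≡q zero) (allᶠ-cong (p≡q ∘ suc))

anyᶠ-cong : ∀ {n} {p q : Fin n → Bool} → (∀ u → p u ≡ q u) → anyᶠ p ≡ anyᶠ q
anyᶠ-cong {zero}  p≡q = refl
anyᶠ-cong {suc n} p≡q = cong₂ _∨_ (p≡q zero) (anyᶠ-cong (p≡q ∘ suc))

allᶠ-∧ : ∀ {n} (p q : Fin n → Bool) → allᶠ (λ u → p u ∧ q u) ≡ allᶠ p ∧ allᶠ q
allᶠ-∧ {zero}  p q = refl
allᶠ-∧ {suc n} p q = trans (cong ((p zero ∧ q zero) ∧_) (allᶠ-∧ (p ∘ suc) (q ∘ suc)))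
                           (∧-Props.interchange (p zero) (q zero) _ _)

anyᶠ-∨ : ∀ {n} (p q : Fin n → Bool) → anyᶠ (λ u → p u ∨ q u) ≡ anyᶠ p ∨ anyᶠ q
anyᶠ-∨ {zero}  p q = refl
anyᶠ-∨ {suc n} p q = trans (cong ((p zero ∨ q zero) ∨_) (anyᶠ-∨ (p ∘ suc) (q ∘ suc)))
                           (∨-Props.interchange (p zero) (q zero) _ _)

anyᶠ-const-∧ : ∀ {n} (c : Bool) (p : Fin n → Bool) → anyᶠ (λ u → c ∧ p u) ≡ c ∧ anyᶠ p
anyᶠ-const-∧ {zero}  c p = sym (∧-zeroʳ c)
anyᶠ-const-∧ {suc n} c p = trans (cong ((c ∧ p zero) ∨_) (anyᶠ-const-∧ c (p ∘ suc)))
                                 (sym (∧-distribˡ-∨ c (p zero) _))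

anyᶠ-false : ∀ {n} → anyᶠ {n} (λ _ → false) ≡ false
anyᶠ-false {zero}  = refl
anyᶠ-false {suc n} = anyᶠ-false {n}

not-anyᶠ : ∀ {n} (p : Fin n → Bool) → not (anyᶠ p) ≡ allᶠ (not ∘ p)
not-anyᶠ {zero}  p = refl
not-anyᶠ {suc n} p with p zero
... | true  = refl
... | false = not-anyᶠ (p ∘ suc)

allᶠ-at : ∀ {n} (v : Fin n) (p : Fin n → Bool) → allᶠ p ≡ p v ∧ allᶠ (λ u → (u == v) ∨ p u)
allᶠ-at zero    p with p zero
... | true  = refl
... | false = refl
allᶠ-at (suc v) p = begin
    p zero ∧ allᶠ (p ∘ suc)                                     ≡⟨ cong (p zero ∧_) (allᶠ-at v (p ∘ suc)) ⟩
    p zero ∧ (p (suc v) ∧ allᶠ (λ u → (u == v) ∨ p (suc u)))    ≡⟨ ∧-Props.x∙yz≈y∙xz (p zero) (p (suc v)) _ ⟩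
    p (suc v) ∧ (p zero ∧ allᶠ (λ u → (u == v) ∨ p (suc u)))
      ≡⟨ cong (λ z → p (suc v) ∧ (p zero ∧ z)) (allᶠ-cong (λ u → cong (_∨ p (suc u)) (sym (==-suc u v)))) ⟩
    p (suc v) ∧ allᶠ (λ u → (u == suc v) ∨ p u)                 ∎
  where open ≡-Reasoning

anyᶠ-at : ∀ {n} (v : Fin n) (p : Fin n → Bool) → anyᶠ p ≡ p v ∨ anyᶠ (λ u → not (u == v) ∧ p u)
anyᶠ-at zero    p with p zero
... | true  = refl
... | false = refl
anyᶠ-at (suc v) p = begin
    p zero ∨ anyᶠ (p ∘ suc)                                          ≡⟨ cong (p zero ∨_) (anyᶠ-at v (p ∘ suc)) ⟩
    p zero ∨ (p (suc v) ∨ anyᶠ (λ u → not (u == v) ∧ p (suc u)))     ≡⟨ ∨-Props.x∙yz≈y∙xz (p zero) (p (suc v)) _ ⟩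
    p (suc v) ∨ (p zero ∨ anyᶠ (λ u → not (u == v) ∧ p (suc u)))
      ≡⟨ cong (λ z → p (suc v) ∨ (p zero ∨ z)) (anyᶠ-cong (λ u → cong (λ b → not b ∧ p (suc u)) (sym (==-suc u v)))) ⟩
    p (suc v) ∨ anyᶠ (λ u → not (u == suc v) ∧ p u)                  ∎
  where open ≡-Reasoning

anyᶠ-only : ∀ {n} (v : Fin n) (p : Fin n → Bool) → anyᶠ (λ u → (u == v) ∧ p u) ≡ p v
anyᶠ-only {n} v p = begin
    anyᶠ (λ u → (u == v) ∧ p u)                                    ≡⟨ anyᶠ-at v _ ⟩
    ((v == v) ∧ p v) ∨ anyᶠ (λ u → not (u == v) ∧ ((u == v) ∧ p u))
      ≡⟨ cong₂ _∨_ (cong (_∧ p v) (==-refl v)) (trans (anyᶠ-cong excluded) (anyᶠ-false {n})) ⟩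
    p v ∨ false                                                     ≡⟨ ∨-identityʳ (p v) ⟩
    p v                                                             ∎
  where
  open ≡-Reasoning
  excluded : ∀ u → not (u == v) ∧ ((u == v) ∧ p u) ≡ false
  excluded u with u == v
  ... | true  = refl
  ... | false = refl

∧-T₁ : ∀ a {b} → T (a ∧ b) → T a
∧-T₁ true _ = _

∧-T₂ : ∀ a {b} → T (a ∧ b) → T b
∧-T₂ true t = t

allᶠ-T : ∀ {n} {p : Fin n → Bool} → T (allᶠ p) → ∀ u → T (p u)
allᶠ-T {suc n} {p} t zero    = ∧-T₁ (p zero) t
allᶠ-T {suc n} {p} t (suc u) = allᶠ-T {n} {p ∘ suc} (∧-T₂ (p zero) t) u

∧-guard : ∀ (a b c : Bool) → (T a → b ≡ c) → a ∧ b ≡ a ∧ c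
∧-guard true  b c b≡c = b≡c _
∧-guard false b c b≡c = refl

∧-falseˡ : ∀ {a b} → a ≡ false → a ∧ b ≡ false
∧-falseˡ refl = refl

T-not : ∀ {b} → T (not b) → b ≡ false
T-not {false} _ = refl

not-anyᶠ-at : ∀ {n} (p : Fin n → Bool) → T (not (anyᶠ p)) → ∀ u → p u ≡ false
not-anyᶠ-at p t u = T-not (allᶠ-T (subst T (not-anyᶠ p) t) u)

reaches : ∀ {n} → Subset n → (Fin n → Fin n → Bool) → Fin n → Bool
reaches W R u = anyᶠ (λ w → lookup W w ∧ R w u)

covered : ∀ {n} → (Fin n → Bool) → (Fin n → Fin n → Bool) → Subset n → Fin n → Bool
covered T R W u = not (T u) ∨ (lookup W u ∨ reaches W R u)

inside : ∀ {n} → (Fin n → Bool) → Subset n → Bool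
inside A W = allᶠ (λ u → not (lookup W u) ∨ A u)

meets : ∀ {n} → Subset n → (Fin n → Bool) → Bool
meets W X = anyᶠ (λ u → lookup W u ∧ X u)

edges : ∀ {n} → (Fin n → Bool) → (Fin n → Fin n → Bool) → Fin n → Fin n → Bool
edges A a w u = A w ∧ (A u ∧ a w u)

within-char : ∀ {n} (H : Graph n) (W : Subset n) → within H W ≡ inside (V H) W
within-char H W = all-tabulate (λ u → not (lookup W u) ∨ V H u) (λ u → u)

dominating-char : ∀ {n} (H : Graph n) (W : Subset n) → dominating H W ≡ allᶠ (covered (V H) (E H) W)
dominating-char {n} H W =
  trans (all-tabulate (λ u → not (V H u) ∨ (lookup W u ∨ any (λ w → lookup W w ∧ E H w u) (allFin n))) (λ u → u))
        (allᶠ-cong (λ u → cong (λ b → not (V H u) ∨ (lookup W u ∨ b))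
                               (any-tabulate (λ w → lookup W w ∧ E H w u) (λ w → w))))

isDomSet-char : ∀ {n} (H : Graph n) (W : Subset n) →
  isDomSet H W ≡ inside (V H) W ∧ allᶠ (covered (V H) (E H) W)
isDomSet-char H W = cong₂ _∧_ (within-char H W) (dominating-char H W)

E-sym : ∀ {n} (H : Graph n) u w → E H u w ≡ E H w u
E-sym H u w rewrite adj-sym H u w = ∧-Props.x∙yz≈y∙xz (V H u) (V H w) (adj H w u)

meets-point : ∀ {n} (W : Subset n) (v : Fin n) → meets W (_== v) ≡ lookup W v
meets-point W v = trans (anyᶠ-cong (λ u → ∧-comm (lookup W u) (u == v))) (anyᶠ-only v (lookup W))

meets-closedNbhd : ∀ {n} (H : Graph n) (W : Subset n) (v : Fin n) →
  meets W (λ u → (u == v) ∨ E H v u) ≡ lookup W v ∨ reaches W (E H) v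
meets-closedNbhd H W v = begin
    meets W (λ u → (u == v) ∨ E H v u)
      ≡⟨ anyᶠ-cong (λ u → ∧-distribˡ-∨ (lookup W u) (u == v) (E H v u)) ⟩
    anyᶠ (λ u → (lookup W u ∧ (u == v)) ∨ (lookup W u ∧ E H v u))
      ≡⟨ anyᶠ-∨ (λ u → lookup W u ∧ (u == v)) (λ u → lookup W u ∧ E H v u) ⟩
    meets W (_== v) ∨ anyᶠ (λ u → lookup W u ∧ E H v u)
      ≡⟨ cong₂ _∨_ (meets-point W v) (anyᶠ-cong (λ u → cong (lookup W u ∧_) (E-sym H v u))) ⟩
    lookup W v ∨ reaches W (E H) v  ∎
  where open ≡-Reasoning

meets-insert : ∀ {n} (W : Subset n) (v : Fin n) (X : Fin n → Bool) → X v ≡ true → meets (insert v W) X ≡ true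
meets-insert W v X v∈X =
  trans (anyᶠ-at v (λ u → lookup (insert v W) u ∧ X u))
        (cong (λ b → b ∨ anyᶠ (λ u → not (u == v) ∧ (lookup (insert v W) u ∧ X u))) v∈W∪v∩X)
  where
  v∈W∪v∩X : lookup (insert v W) v ∧ X v ≡ true
  v∈W∪v∩X rewrite lookup-insert v v W | ==-refl v | v∈X = refl

-- Removing a set X of vertices from the graph (A, edges A a).  Both H − v and H − N[v], and the
-- vertex set of H / v, are of this form, so the effect on domination is computed once here.
module Removal {n} (A X : Fin n → Bool) (a : Fin n → Fin n → Bool) where

  A∖X : Fin n → Bool
  A∖X u = A u ∧ not (X u)

  inside-removal : ∀ W → inside A∖X W ≡ inside A W ∧ not (meets W X)
  inside-removal W = begin
      inside A∖X W
        ≡⟨ allᶠ-cong (λ u → pointwise (lookup W u) (A u) (X u)) ⟩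
      allᶠ (λ u → (not (lookup W u) ∨ A u) ∧ not (lookup W u ∧ X u))
        ≡⟨ allᶠ-∧ (λ u → not (lookup W u) ∨ A u) (λ u → not (lookup W u ∧ X u)) ⟩
      inside A W ∧ allᶠ (λ u → not (lookup W u ∧ X u))
        ≡⟨ cong (inside A W ∧_) (sym (not-anyᶠ (λ u → lookup W u ∧ X u))) ⟩
      inside A W ∧ not (meets W X)  ∎
    where
    open ≡-Reasoning
    pointwise : ∀ w b x → not w ∨ (b ∧ not x) ≡ (not w ∨ b) ∧ not (w ∧ x)
    pointwise false b x = refl
    pointwise true  b x = refl

  reaches-removal : ∀ W → (∀ w → lookup W w ∧ X w ≡ false) → ∀ u →
    reaches W (edges A∖X a) u ≡ not (X u) ∧ reaches W (edges A a) u
  reaches-removal W W∩X=∅ u =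
    trans (anyᶠ-cong (λ w → pointwise (lookup W w) (X w) (A w) (A u) (X u) (a w u) (W∩X=∅ w)))
          (anyᶠ-const-∧ (not (X u)) (λ w → lookup W w ∧ edges A a w u))
    where
    pointwise : ∀ iw xw Aw Au xu e → iw ∧ xw ≡ false →
      iw ∧ ((Aw ∧ not xw) ∧ ((Au ∧ not xu) ∧ e)) ≡ not xu ∧ (iw ∧ (Aw ∧ (Au ∧ e)))
    pointwise false _     _     _     xu _ _ = sym (∧-zeroʳ (not xu))
    pointwise true  false false _     xu _ _ = sym (∧-zeroʳ (not xu))
    pointwise true  false true  false xu _ _ = sym (∧-zeroʳ (not xu))
    pointwise true  false true  true  xu e _ = refl

  covered-removal : ∀ W → (∀ w → lookup W w ∧ X w ≡ false) → ∀ u →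
    covered A∖X (edges A∖X a) W u ≡ X u ∨ covered A (edges A a) W u
  covered-removal W W∩X=∅ u =
    trans (cong (λ r → not (A∖X u) ∨ (lookup W u ∨ r)) (reaches-removal W W∩X=∅ u))
          (pointwise (A u) (X u) (lookup W u) (reaches W (edges A a) u))
    where
    pointwise : ∀ b x w r → not (b ∧ not x) ∨ (w ∨ (not x ∧ r)) ≡ x ∨ (not b ∨ (w ∨ r))
    pointwise false true  w r = refl
    pointwise true  true  w r = refl
    pointwise false false w r = refl
    pointwise true  false w r = refl

  domSet-removal : ∀ W →
    inside A∖X W ∧ allᶠ (covered A∖X (edges A∖X a) W)
      ≡ inside A W ∧ (not (meets W X) ∧ allᶠ (λ u → X u ∨ covered A (edges A a) W u))
  domSet-removal W = begin
      inside A∖X W ∧ allᶠ (covered A∖X (edges A∖X a) W)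
        ≡⟨ cong (_∧ allᶠ (covered A∖X (edges A∖X a) W)) (inside-removal W) ⟩
      (inside A W ∧ not (meets W X)) ∧ allᶠ (covered A∖X (edges A∖X a) W)
        ≡⟨ ∧-assoc (inside A W) _ _ ⟩
      inside A W ∧ (not (meets W X) ∧ allᶠ (covered A∖X (edges A∖X a) W))
        ≡⟨ cong (inside A W ∧_) (∧-guard (not (meets W X)) _ _ (λ t →
             allᶠ-cong (covered-removal W (not-anyᶠ-at (λ u → lookup W u ∧ X u) t)))) ⟩
      inside A W ∧ (not (meets W X) ∧ allᶠ (λ u → X u ∨ covered A (edges A a) W u))  ∎
    where open ≡-Reasoning

  inside-removal-insert : ∀ W v → X v ≡ true → inside A∖X (insert v W) ≡ false
  inside-removal-insert W v v∈X =
    trans (inside-removal (insert v W))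
          (trans (cong (λ b → inside A (insert v W) ∧ not b) (meets-insert W v X v∈X))
                 (∧-zeroʳ (inside A (insert v W))))

reaches-insert : ∀ {n} (H : Graph n) (W : Subset n) (v u : Fin n) →
  reaches (insert v W) (E H) u ≡ E H v u ∨ reaches W (E H) u
reaches-insert H W v u = begin
    reaches (insert v W) (E H) u
      ≡⟨ anyᶠ-cong (λ w → trans (cong (_∧ E H w u) (lookup-insert v w W))
                                (∧-distribʳ-∨ (E H w u) (w == v) (lookup W w))) ⟩
    anyᶠ (λ w → ((w == v) ∧ E H w u) ∨ (lookup W w ∧ E H w u))
      ≡⟨ anyᶠ-∨ (λ w → (w == v) ∧ E H w u) (λ w → lookup W w ∧ E H w u) ⟩
    anyᶠ (λ w → (w == v) ∧ E H w u) ∨ reaches W (E H) u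
      ≡⟨ cong (_∨ reaches W (E H) u) (anyᶠ-only v (λ w → E H w u)) ⟩
    E H v u ∨ reaches W (E H) u  ∎
  where open ≡-Reasoning

E-endpoint : ∀ {n} (H : Graph n) w u → E H w u ∧ not (V H u) ≡ false
E-endpoint H w u with V H w | V H u
... | false | _     = refl
... | true  | false = refl
... | true  | true  = ∧-zeroʳ (adj H w u)

-- In H / v the new edges join distinct neighbours of v; they need no separate vertex condition.
contract-edges : ∀ {n} (H : Graph n) (v w u : Fin n) →
  edges (V H) (contractAdj H v) w u ≡ E H w u ∨ (not (w == u) ∧ (E H v w ∧ E H v u))
contract-edges H v w u = begin
    V H w ∧ (V H u ∧ (adj H w u ∨ new))
      ≡⟨ cong (V H w ∧_) (∧-distribˡ-∨ (V H u) (adj H w u) new) ⟩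
    V H w ∧ ((V H u ∧ adj H w u) ∨ (V H u ∧ new))
      ≡⟨ ∧-distribˡ-∨ (V H w) (V H u ∧ adj H w u) (V H u ∧ new) ⟩
    E H w u ∨ (V H w ∧ (V H u ∧ new))
      ≡⟨ cong (E H w u ∨_) (absorb (V H w) (V H u) (not (w == u)) (E H v w) (E H v u)
                                   (E-endpoint H v w) (E-endpoint H v u)) ⟩
    E H w u ∨ new  ∎
  where
  open ≡-Reasoning
  new : Bool
  new = not (w == u) ∧ (E H v w ∧ E H v u)
  absorb : ∀ Vw Vu ne ew eu → ew ∧ not Vw ≡ false → eu ∧ not Vu ≡ false →
    Vw ∧ (Vu ∧ (ne ∧ (ew ∧ eu))) ≡ ne ∧ (ew ∧ eu)
  absorb true  true  ne    ew    eu    _  _  = refl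
  absorb false _     ne    true  eu    () _
  absorb false _     false false eu    _  _  = refl
  absorb false _     true  false eu    _  _  = refl
  absorb true  false ne    ew    true  _  ()
  absorb true  false false ew    false _  _  = refl
  absorb true  false true  false false _  _  = refl
  absorb true  false true  true  false _  _  = refl

reaches-contract : ∀ {n} (H : Graph n) (W : Subset n) (v u : Fin n) →
  reaches W (edges (V H) (contractAdj H v)) u
    ≡ reaches W (E H) u ∨ (E H v u ∧ anyᶠ (λ w → not (w == u) ∧ (lookup W w ∧ E H v w)))
reaches-contract H W v u = begin
    reaches W (edges (V H) (contractAdj H v)) u
      ≡⟨ anyᶠ-cong (λ w → trans (cong (lookup W w ∧_) (contract-edges H v w u))
                                (∧-distribˡ-∨ (lookup W w) (E H w u) _)) ⟩
    anyᶠ (λ w → (lookup W w ∧ E H w u) ∨ (lookup W w ∧ (not (w == u) ∧ (E H v w ∧ E H v u))))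
      ≡⟨ anyᶠ-∨ (λ w → lookup W w ∧ E H w u) _ ⟩
    reaches W (E H) u ∨ anyᶠ (λ w → lookup W w ∧ (not (w == u) ∧ (E H v w ∧ E H v u)))
      ≡⟨ cong (reaches W (E H) u ∨_)
              (trans (anyᶠ-cong (λ w → rearrange (lookup W w) (not (w == u)) (E H v w) (E H v u)))
                     (anyᶠ-const-∧ (E H v u) (λ w → not (w == u) ∧ (lookup W w ∧ E H v w)))) ⟩
    reaches W (E H) u ∨ (E H v u ∧ anyᶠ (λ w → not (w == u) ∧ (lookup W w ∧ E H v w)))  ∎
  where
  open ≡-Reasoning
  rearrange : ∀ i ne ew eu → i ∧ (ne ∧ (ew ∧ eu)) ≡ eu ∧ (ne ∧ (i ∧ ew))
  rearrange = solve-∨∧ 4 (λ i ne ew eu → i :* (ne :* (ew :* eu)) := eu :* (ne :* (i :* ew))) refl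

covered-contract : ∀ {n} (H : Graph n) (W : Subset n) (v u : Fin n) →
  covered (V H) (edges (V H) (contractAdj H v)) W u
    ≡ covered (V H) (E H) W u ∨ (E H v u ∧ reaches W (E H) v)
covered-contract H W v u = begin
    not (V H u) ∨ (lookup W u ∨ reaches W (edges (V H) (contractAdj H v)) u)
      ≡⟨ cong (λ r → not (V H u) ∨ (lookup W u ∨ r)) (reaches-contract H W v u) ⟩
    not (V H u) ∨ (lookup W u ∨ (reaches W (E H) u ∨ (E H v u ∧ others)))
      ≡⟨ pointwise (V H u) (lookup W u) (reaches W (E H) u) (E H v u) others ⟩
    covered (V H) (E H) W u ∨ (E H v u ∧ ((lookup W u ∧ E H v u) ∨ others))
      ≡⟨ cong (λ r → covered (V H) (E H) W u ∨ (E H v u ∧ r)) (sym v-reached) ⟩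
    covered (V H) (E H) W u ∨ (E H v u ∧ reaches W (E H) v)  ∎
  where
  open ≡-Reasoning
  others : Bool
  others = anyᶠ (λ w → not (w == u) ∧ (lookup W w ∧ E H v w))
  v-reached : reaches W (E H) v ≡ (lookup W u ∧ E H v u) ∨ others
  v-reached = trans (anyᶠ-cong (λ w → cong (lookup W w ∧_) (E-sym H w v)))
                    (anyᶠ-at u (λ w → lookup W w ∧ E H v w))
  pointwise : ∀ b w r e s → not b ∨ (w ∨ (r ∨ (e ∧ s))) ≡ (not b ∨ (w ∨ r)) ∨ (e ∧ ((w ∧ e) ∨ s))
  pointwise false w     r e s = refl
  pointwise true  true  r e s = refl
  pointwise true  false r e s = refl

isPartialDomSet : ∀ {n} → Graph n → Fin n → Subset n → Bool
isPartialDomSet H v W = within (deleteN H v) W ∧ dominating (delete H v) W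

P : ∀ {n} → Graph n → Fin n → ℚ → ℚ
P H v x = ∑ (λ W → ind (isPartialDomSet H v W) (x ^ ∣ W ∣))

module DerivedGraphs {n} (H : Graph n) (v : Fin n) where

  N[v] : Fin n → Bool
  N[v] u = (u == v) ∨ E H v u

  module Del  = Removal (V H) (_== v) (adj H)
  module DelN = Removal (V H) N[v] (adj H)
  module Con  = Removal (V H) (_== v) (contractAdj H v)

  v∈N[v] : N[v] v ≡ true
  v∈N[v] = cong (_∨ E H v v) (==-refl v)

  delete-insert : ∀ W → isDomSet (delete H v) (insert v W) ≡ false
  delete-insert W = trans (isDomSet-char (delete H v) (insert v W))
                          (∧-falseˡ (Del.inside-removal-insert W v (==-refl v)))

  deleteN-insert : ∀ W → isDomSet (deleteN H v) (insert v W) ≡ false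
  deleteN-insert W = trans (isDomSet-char (deleteN H v) (insert v W))
                           (∧-falseˡ (DelN.inside-removal-insert W v v∈N[v]))

  contract-insert : ∀ W → isDomSet (contract H v) (insert v W) ≡ false
  contract-insert W = trans (isDomSet-char (contract H v) (insert v W))
                            (∧-falseˡ (Con.inside-removal-insert W v (==-refl v)))

  partial-insert : ∀ W → isPartialDomSet H v (insert v W) ≡ false
  partial-insert W = ∧-falseˡ (trans (within-char (deleteN H v) (insert v W))
                                        (DelN.inside-removal-insert W v v∈N[v]))

-- For a vertex v of H and a set W ∌ v, every domination condition in the recurrence, at W and at
-- W ∪ {v}, is determined by three Booleans: whether v has a neighbour in W, whether W ⊆ V(H)
-- dominates all vertices other than v, and whether it dominates all vertices outside N[v].
module NormalForms {n} (H : Graph n) (v : Fin n) (v∈H : V H v ≡ true) (W : Subset n) (v∉W : lookup W v ≡ false) where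
  open DerivedGraphs H v

  W⊆H : Bool
  W⊆H = inside (V H) W

  v-reached : Bool
  v-reached = reaches W (E H) v

  coversAway : Bool
  coversAway = allᶠ (λ u → (u == v) ∨ covered (V H) (E H) W u)

  coversOutsideN : Bool
  coversOutsideN = allᶠ (λ u → N[v] u ∨ covered (V H) (E H) W u)

  dominatesAway : Bool
  dominatesAway = W⊆H ∧ coversAway

  dominatesOutsideN : Bool
  dominatesOutsideN = W⊆H ∧ coversOutsideN

  W∌v : ∀ u → lookup W u ∧ (u == v) ≡ false
  W∌v u = not-anyᶠ-at (λ u → lookup W u ∧ (u == v)) (subst (T ∘ not) (sym (trans (meets-point W v) v∉W)) _) u

  meets-N[v] : meets W N[v] ≡ v-reached
  meets-N[v] = trans (meets-closedNbhd H W v) (cong (_∨ v-reached) v∉W)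

  isDom-H : isDomSet H W ≡ v-reached ∧ dominatesAway
  isDom-H = trans (isDomSet-char H W)
    (trans (cong (W⊆H ∧_) (trans (allᶠ-at v (covered (V H) (E H) W)) (cong (_∧ coversAway) v-covered)))
           (∧-Props.x∙yz≈y∙xz W⊆H v-reached coversAway))
    where
    v-covered : covered (V H) (E H) W v ≡ v-reached
    v-covered rewrite v∈H | v∉W = refl

  isDom-delete : isDomSet (delete H v) W ≡ dominatesAway
  isDom-delete = trans (isDomSet-char (delete H v) W)
    (trans (Del.domSet-removal W) (cong (λ b → W⊆H ∧ (not b ∧ coversAway)) (trans (meets-point W v) v∉W)))

  isDom-deleteN : isDomSet (deleteN H v) W ≡ not v-reached ∧ dominatesOutsideN
  isDom-deleteN = trans (isDomSet-char (deleteN H v) W)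
    (trans (DelN.domSet-removal W)
           (trans (cong (λ b → W⊆H ∧ (not b ∧ coversOutsideN)) meets-N[v])
                  (∧-Props.x∙yz≈y∙xz W⊆H (not v-reached) coversOutsideN)))

  isPartial : isPartialDomSet H v W ≡ not v-reached ∧ dominatesAway
  isPartial = trans
    (cong₂ _∧_ (trans (within-char (deleteN H v) W) (trans (DelN.inside-removal W) (cong (λ b → W⊆H ∧ not b) meets-N[v])))
               (trans (dominating-char (delete H v) W) (allᶠ-cong (Del.covered-removal W W∌v))))
    (∧-Props.xy∙z≈y∙xz W⊆H (not v-reached) coversAway)

  -- In H / v the neighbours of v dominate each other exactly when v is reached.
  isDom-contract : isDomSet (contract H v) W ≡ (if v-reached then dominatesOutsideN else dominatesAway)
  isDom-contract = trans (isDomSet-char (contract H v) W)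
    (trans (Con.domSet-removal W)
           (trans (cong₂ (λ b d → W⊆H ∧ (not b ∧ d)) (trans (meets-point W v) v∉W)
                         (allᶠ-cong (λ u → cong ((u == v) ∨_) (covered-contract H W v u))))
                  by-cases))
    where
    by-cases : W⊆H ∧ allᶠ (λ u → (u == v) ∨ (covered (V H) (E H) W u ∨ (E H v u ∧ v-reached)))
               ≡ (if v-reached then dominatesOutsideN else dominatesAway)
    by-cases with v-reached
    ... | true  = cong (W⊆H ∧_) (allᶠ-cong (λ u → pointwise (u == v) (covered (V H) (E H) W u) (E H v u)))
      where
      pointwise : ∀ i c e → i ∨ (c ∨ (e ∧ true)) ≡ (i ∨ e) ∨ c
      pointwise = solve-∨∧ 3 (λ i c e → i :+ (c :+ (e :* ∨-∧-Solver.con true)) := (i :+ e) :+ c) refl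
    ... | false = cong (W⊆H ∧_) (allᶠ-cong (λ u → cong ((u == v) ∨_)
                    (trans (cong (covered (V H) (E H) W u ∨_) (∧-zeroʳ (E H v u))) (∨-identityʳ _))))

  isDom-insert : isDomSet H (insert v W) ≡ dominatesOutsideN
  isDom-insert = trans (isDomSet-char H (insert v W)) (cong₂ _∧_
    (allᶠ-cong (λ u → trans (cong (λ b → not b ∨ V H u) (lookup-insert v u W))
                            (v∈H-pointwise (u == v) (lookup W u) (V H u) (only-v-is-v u))))
    (allᶠ-cong (λ u → trans (cong₂ (λ b r → not (V H u) ∨ (b ∨ r)) (lookup-insert v u W) (reaches-insert H W v u))
                            (rearrange (not (V H u)) (u == v) (lookup W u) (E H v u) (reaches W (E H) u)))))
    where
    only-v-is-v : ∀ u → (u == v) ∧ not (V H u) ≡ false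
    only-v-is-v u with u ≟ v
    ... | yes refl rewrite v∈H = refl
    ... | no  _    = refl
    v∈H-pointwise : ∀ i w b → i ∧ not b ≡ false → not (i ∨ w) ∨ b ≡ not w ∨ b
    v∈H-pointwise false w     b     _ = refl
    v∈H-pointwise true  true  true  _ = refl
    v∈H-pointwise true  false true  _ = refl
    rearrange : ∀ nb i w e r → nb ∨ ((i ∨ w) ∨ (e ∨ r)) ≡ (i ∨ e) ∨ (nb ∨ (w ∨ r))
    rearrange = solve-∨∧ 5 (λ nb i w e r → nb :+ ((i :+ w) :+ (e :+ r)) := (i :+ e) :+ (nb :+ (w :+ r))) refl
-- The identity behind the recurrence on a pair {W, W ∪ {v}} (y = x^|W|), in terms of
-- r: v has a neighbour in W;  a: W dominates H − v;  b: W ∪ {v} dominates H.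
-- Left: W in D(H), W in p_v(H) (weighted 1 + x), W ∪ {v} in D(H).  Right: W in D(H / v)
-- (weighted x), in D(H − v), in D(H − N[v]) (weighted x); W ∪ {v} contributes nothing else.
pair-identity : ∀ (r a b : Bool) (x y : ℚ) →
  (ind (r ∧ a) y + (1ℚ + x) * ind (not r ∧ a) y) + (x * ind b y + (1ℚ + x) * 0ℚ)
    ≡ (x * ind (if r then b else a) y + ind a y + x * ind (not r ∧ b) y) + (x * 0ℚ + 0ℚ + x * 0ℚ)
pair-identity true  a b x y = reached x (ind a y) (ind b y)
  where
  reached : ∀ x α β → (α + (1ℚ + x) * 0ℚ) + (x * β + (1ℚ + x) * 0ℚ)
                        ≡ (x * β + α + x * 0ℚ) + (x * 0ℚ + 0ℚ + x * 0ℚ)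
  reached = solve-∀ ℚ-ring
pair-identity false a b x y = unreached x (ind a y) (ind b y)
  where
  unreached : ∀ x α β → (0ℚ + (1ℚ + x) * α) + (x * β + (1ℚ + x) * 0ℚ)
                          ≡ (x * α + α + x * β) + (x * 0ℚ + 0ℚ + x * 0ℚ)
  unreached = solve-∀ ℚ-ring

D-∑ : ∀ {n} (H : Graph n) (x : ℚ) → D H x ≡ ∑ (λ W → ind (isDomSet H W) (x ^ ∣ W ∣))
D-∑ {n} H x = sumOf-filter (λ W → x ^ ∣ W ∣) (isDomSet H) (allSubsets n)

module VertexRecurrence {n} (H : Graph n) (v : Fin n) (v∈H : V H v ≡ true) (x : ℚ) where
  open DerivedGraphs H v

  dom : Graph n → Subset n → ℚ
  dom G W = ind (isDomSet G W) (x ^ ∣ W ∣)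

  partial : Subset n → ℚ
  partial W = ind (isPartialDomSet H v W) (x ^ ∣ W ∣)

  lhs : Subset n → ℚ
  lhs W = dom H W + (1ℚ + x) * partial W

  rhs : Subset n → ℚ
  rhs W = x * dom (contract H v) W + dom (delete H v) W + x * dom (deleteN H v) W

  module Pair (W : Subset n) (v∉W : lookup W v ≡ false) where
    open NormalForms H v v∈H W v∉W

    paired : lhs W + lhs (insert v W) ≡ rhs W + rhs (insert v W)
    paired
      rewrite ∣insert∣ v W v∉W | isDom-H | isPartial | isDom-insert | partial-insert W
            | isDom-contract | isDom-delete | isDom-deleteN
            | contract-insert W | delete-insert W | deleteN-insert W
            | ind-scale dominatesOutsideN x (x ^ ∣ W ∣)
      = pair-identity v-reached dominatesAway dominatesOutsideN x (x ^ ∣ W ∣)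

  summands-agree : ∑ lhs ≡ ∑ rhs
  summands-agree = trans (∑-pair v lhs) (trans (∑-cong by-pairs) (sym (∑-pair v rhs)))
    where
    by-pairs : ∀ W → (if lookup W v then 0ℚ else lhs W + lhs (insert v W))
                     ≡ (if lookup W v then 0ℚ else rhs W + rhs (insert v W))
    by-pairs W with lookup W v in v∈?W
    ... | true  = refl
    ... | false = Pair.paired W v∈?W

vertex-recurrence : ∀ {n} (H : Graph n) (v : Fin n) → V H v ≡ true → (x : ℚ) →
  D H x + (1ℚ + x) * P H v x ≡ x * D (contract H v) x + D (delete H v) x + x * D (deleteN H v) x
vertex-recurrence H v v∈H x = begin
    D H x + (1ℚ + x) * P H v x
      ≡⟨ cong₂ _+_ (D-∑ H x) (sym (∑-* (1ℚ + x) partial)) ⟩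
    ∑ (dom H) + ∑ (λ W → (1ℚ + x) * partial W)
      ≡⟨ sym (∑-+ (dom H) (λ W → (1ℚ + x) * partial W)) ⟩
    ∑ lhs
      ≡⟨ summands-agree ⟩
    ∑ rhs
      ≡⟨ ∑-+ (λ W → x * dom (contract H v) W + dom (delete H v) W) (λ W → x * dom (deleteN H v) W) ⟩
    ∑ (λ W → x * dom (contract H v) W + dom (delete H v) W) + ∑ (λ W → x * dom (deleteN H v) W)
      ≡⟨ cong₂ _+_ (∑-+ (λ W → x * dom (contract H v) W) (dom (delete H v))) (∑-* x (dom (deleteN H v))) ⟩
    (∑ (λ W → x * dom (contract H v) W) + ∑ (dom (delete H v))) + x * ∑ (dom (deleteN H v))
      ≡⟨ cong₂ (λ c m → c + ∑ (dom (delete H v)) + x * m) (∑-* x (dom (contract H v))) refl ⟩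
    x * ∑ (dom (contract H v)) + ∑ (dom (delete H v)) + x * ∑ (dom (deleteN H v))
      ≡⟨ sym (cong₂ (λ c m → x * c + ∑ (dom (delete H v)) + x * m) (D-∑ (contract H v) x) (D-∑ (deleteN H v) x)) ⟩
    x * D (contract H v) x + ∑ (dom (delete H v)) + x * D (deleteN H v) x
      ≡⟨ cong (λ d → x * D (contract H v) x + d + x * D (deleteN H v) x) (sym (D-∑ (delete H v) x)) ⟩
    x * D (contract H v) x + D (delete H v) x + x * D (deleteN H v) x  ∎
  where
  open ≡-Reasoning
  open VertexRecurrence H v v∈H x

_∩ᵖ_ : ∀ {n} → Subset n → (Fin n → Bool) → Subset n
W ∩ᵖ A = W ∩ Vec.tabulate A

lookup-∩ᵖ : ∀ {n} (W : Subset n) (A : Fin n → Bool) u → lookup (W ∩ᵖ A) u ≡ lookup W u ∧ A u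
lookup-∩ᵖ W A u = trans (lookup-zipWith _∧_ u W (Vec.tabulate A)) (cong (lookup W u ∧_) (lookup∘tabulate A u))

-- One step of ∑-product below: the first coordinate of a subset of A ∪ B lies in A, in B, or in neither.
product-step : (a b : Bool) → a ∧ b ≡ false → (X Y : Bool → ℚ) (Z : Bool → Bool → ℚ) →
  (∀ a' b' → X a' * Y b' ≡ Z a' b') →
  (ind a (X true) + X false) * (ind b (Y true) + Y false) ≡ ind (a ∨ b) (Z a b) + Z false false
product-step true  true  () X Y Z XY≡Z
product-step true  false _  X Y Z XY≡Z rewrite sym (XY≡Z true false) | sym (XY≡Z false false) =
  distrib (X true) (X false) (Y false)
  where
  distrib : ∀ p q r → (p + q) * (0ℚ + r) ≡ p * r + q * r
  distrib = solve-∀ ℚ-ring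
product-step false true  _  X Y Z XY≡Z rewrite sym (XY≡Z false true) | sym (XY≡Z false false) =
  distrib (X false) (Y true) (Y false)
  where
  distrib : ∀ q p r → (0ℚ + q) * (p + r) ≡ q * p + q * r
  distrib = solve-∀ ℚ-ring
product-step false false _  X Y Z XY≡Z rewrite sym (XY≡Z false false) =
  distrib (X false) (Y false)
  where
  distrib : ∀ q r → (0ℚ + q) * (0ℚ + r) ≡ 0ℚ + q * r
  distrib = solve-∀ ℚ-ring

-- For disjoint A and B, a sum over subsets of A times a sum over subsets of B is a sum over
-- subsets W of A ∪ B, each of which splits as (W ∩ A) ∪ (W ∩ B).
∑-product : ∀ {n} (A B : Fin n → Bool) → (∀ u → A u ∧ B u ≡ false) → (f g : Subset n → ℚ) →
  ∑ (λ W → ind (inside A W) (f W)) * ∑ (λ W → ind (inside B W) (g W))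
    ≡ ∑ (λ W → ind (inside (λ u → A u ∨ B u) W) (f (W ∩ᵖ A) * g (W ∩ᵖ B)))
∑-product {zero} A B A∩B=∅ f g = distrib (f []) (g [])
  where
  distrib : ∀ p q → (p + 0ℚ) * (q + 0ℚ) ≡ p * q + 0ℚ
  distrib = solve-∀ ℚ-ring
∑-product {suc n} A B A∩B=∅ f g = begin
    ∑ (λ W → ind (inside A W) (f W)) * ∑ (λ W → ind (inside B W) (g W))
      ≡⟨ cong₂ _*_ (by-first A X (λ _ → refl)) (by-first B Y (λ _ → refl)) ⟩
    (ind (A zero) (X true) + X false) * (ind (B zero) (Y true) + Y false)
      ≡⟨ product-step (A zero) (B zero) (A∩B=∅ zero) X Y Z
           (λ a b → ∑-product (A ∘ suc) (B ∘ suc) (A∩B=∅ ∘ suc) (λ W → f (a ∷ W)) (λ W → g (b ∷ W))) ⟩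
    ind (A zero ∨ B zero) (Z (A zero) (B zero)) + Z false false
      ≡⟨ sym (by-first (λ u → A u ∨ B u) (λ a → Z (a ∧ A zero) (a ∧ B zero)) (λ _ → refl)) ⟩
    ∑ (λ W → ind (inside (λ u → A u ∨ B u) W) (f (W ∩ᵖ A) * g (W ∩ᵖ B)))  ∎
  where
  open ≡-Reasoning
  X : Bool → ℚ
  X a = ∑ (λ W → ind (inside (A ∘ suc) W) (f (a ∷ W)))
  Y : Bool → ℚ
  Y b = ∑ (λ W → ind (inside (B ∘ suc) W) (g (b ∷ W)))
  Z : Bool → Bool → ℚ
  Z a b = ∑ (λ W → ind (inside (λ u → A (suc u) ∨ B (suc u)) W)
                      (f (a ∷ (W ∩ᵖ (A ∘ suc))) * g (b ∷ (W ∩ᵖ (B ∘ suc)))))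
  by-first : (C : Fin (suc n) → Bool) {h : Subset (suc n) → ℚ} (F : Bool → ℚ) →
    (∀ a → F a ≡ ∑ (λ W → ind (inside (C ∘ suc) W) (h (a ∷ W)))) →
    ∑ (λ W → ind (inside C W) (h W)) ≡ ind (C zero) (F true) + F false
  by-first C {h} F F≡ = trans (∑-suc (λ W → ind (inside C W) (h W))) (cong₂ _+_
    (trans (∑-cong (λ W → ind-∧ (C zero) (inside (C ∘ suc) W) (h (true ∷ W))))
           (trans (∑-ind (C zero) (λ W → ind (inside (C ∘ suc) W) (h (true ∷ W))))
                  (cong (ind (C zero)) (sym (F≡ true)))))
    (sym (F≡ false)))

∣∩ᵖ∣-split : ∀ {n} (A B : Fin n → Bool) (W : Subset n) → (∀ u → A u ∧ B u ≡ false) →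
  T (inside (λ u → A u ∨ B u) W) → ∣ W ∣ ≡ ∣ W ∩ᵖ A ∣ +ℕ ∣ W ∩ᵖ B ∣
∣∩ᵖ∣-split A B []          A∩B=∅ W⊆A∪B = refl
∣∩ᵖ∣-split A B (false ∷ W) A∩B=∅ W⊆A∪B = ∣∩ᵖ∣-split (A ∘ suc) (B ∘ suc) W (A∩B=∅ ∘ suc) W⊆A∪B
∣∩ᵖ∣-split A B (true  ∷ W) A∩B=∅ W⊆A∪B with A zero | B zero | A∩B=∅ zero
... | true  | true  | ()
... | true  | false | _ = cong suc (∣∩ᵖ∣-split (A ∘ suc) (B ∘ suc) W (A∩B=∅ ∘ suc) W⊆A∪B)
... | false | true  | _ = trans (cong suc (∣∩ᵖ∣-split (A ∘ suc) (B ∘ suc) W (A∩B=∅ ∘ suc) W⊆A∪B)) (sym (+-suc _ _))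
... | false | false | _ = ⊥-elim W⊆A∪B

^-+ : ∀ (x : ℚ) m k → x ^ (m +ℕ k) ≡ x ^ m * x ^ k
^-+ x zero    k = sym (*-identityˡ (x ^ k))
^-+ x (suc m) k = trans (cong (x *_) (^-+ x m k)) (sym (*-assoc x (x ^ m) (x ^ k)))

record IsDisjointUnion {n} (K K₁ K₂ : Graph n) : Set where
  field
    ∪-vertices : ∀ u → V K u ≡ V K₁ u ∨ V K₂ u
    ∪-edges    : ∀ w u → E K w u ≡ E K₁ w u ∨ E K₂ w u
    ∪-disjoint : ∀ u → V K₁ u ∧ V K₂ u ≡ false
open IsDisjointUnion

∪-swap : ∀ {n} {K K₁ K₂ : Graph n} → IsDisjointUnion K K₁ K₂ → IsDisjointUnion K K₂ K₁
∪-swap {K₁ = K₁} {K₂} U = record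
  { ∪-vertices = λ u → trans (∪-vertices U u) (∨-comm (V K₁ u) (V K₂ u))
  ; ∪-edges    = λ w u → trans (∪-edges U w u) (∨-comm (E K₁ w u) (E K₂ w u))
  ; ∪-disjoint = λ u → trans (∧-comm (V K₂ u) (V K₁ u)) (∪-disjoint U u) }

domPoly : ∀ {n} → Graph n → (Fin n → Bool) → ℚ → ℚ
domPoly K A x = ∑ (λ W → ind (inside A W ∧ allᶠ (covered (V K) (E K) W)) (x ^ ∣ W ∣))

E-source : ∀ {n} (H : Graph n) w u → E H w u ∧ not (V H w) ≡ false
E-source H w u = trans (cong (_∧ not (V H w)) (E-sym H w u)) (E-endpoint H u w)

⊆-true : ∀ {a b} → a ∧ not b ≡ false → a ≡ true → b ≡ true
⊆-true {b = true}  _  _    = refl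
⊆-true {b = false} () refl

==⇒≡ : ∀ {n} {u v : Fin n} → (u == v) ≡ true → u ≡ v
==⇒≡ {u = u} {v} u=v with u ≟ v
... | yes u≡v = u≡v

∧-true₁ : ∀ {a b} → a ∧ b ≡ true → a ≡ true
∧-true₁ {true} _ = refl

∧-true₂ : ∀ {a b} → a ∧ b ≡ true → b ≡ true
∧-true₂ {true} b≡true = b≡true

⊆-false : ∀ {a b} → a ∧ not b ≡ false → b ≡ false → a ≡ false
⊆-false {a} a⊆b refl = trans (sym (∧-identityʳ a)) a⊆b

covered-part : ∀ {n} {K K₁ K₂ : Graph n} → IsDisjointUnion K K₁ K₂ → ∀ {A₁ A₂ : Fin n → Bool} →
  (∀ u → A₂ u ∧ not (V K₂ u) ≡ false) → ∀ W → T (inside (λ u → A₁ u ∨ A₂ u) W) →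
  ∀ u → V K₂ u ≡ false → covered (V K) (E K) W u ≡ covered (V K₁) (E K₁) (W ∩ᵖ A₁) u
covered-part {K = K} {K₁} {K₂} U {A₁} {A₂} A₂⊆K₂ W W⊆A u u∉K₂ =
  cong₂ (λ b c → not b ∨ c)
    (trans (∪-vertices U u) (trans (cong (V K₁ u ∨_) u∉K₂) (∨-identityʳ (V K₁ u))))
    (cong₂ _∨_
      (trans (in-A₁ (lookup W u) (A₁ u) (A₂ u) (allᶠ-T W⊆A u) (⊆-false (A₂⊆K₂ u) u∉K₂)) (sym (lookup-∩ᵖ W A₁ u)))
      (anyᶠ-cong λ w → begin
         lookup W w ∧ E K w u
           ≡⟨ cong (lookup W w ∧_) (trans (∪-edges U w u) (cong (E K₁ w u ∨_) (⊆-false (E-endpoint K₂ w u) u∉K₂))) ⟩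
         lookup W w ∧ (E K₁ w u ∨ false)
           ≡⟨ edge-from-A₁ (lookup W w) (A₁ w) (A₂ w) (V K₁ w) (V K₂ w) (E K₁ w u)
                (allᶠ-T W⊆A w) (A₂⊆K₂ w) (∪-disjoint U w) (E-source K₁ w u) ⟩
         (lookup W w ∧ A₁ w) ∧ E K₁ w u
           ≡⟨ cong (_∧ E K₁ w u) (sym (lookup-∩ᵖ W A₁ w)) ⟩
         lookup (W ∩ᵖ A₁) w ∧ E K₁ w u  ∎))
  where
  open ≡-Reasoning
  in-A₁ : ∀ i a₁ a₂ → T (not i ∨ (a₁ ∨ a₂)) → a₂ ≡ false → i ≡ i ∧ a₁
  in-A₁ false a₁    a₂    _  _  = refl
  in-A₁ true  true  a₂    _  _  = refl
  in-A₁ true  false false () _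
  -- a member of W with an edge of K₁ lies in K₁, hence not in A₂, hence in A₁
  edge-from-A₁ : ∀ i a₁ a₂ v₁ v₂ e₁ → T (not i ∨ (a₁ ∨ a₂)) → a₂ ∧ not v₂ ≡ false → v₁ ∧ v₂ ≡ false →
    e₁ ∧ not v₁ ≡ false → i ∧ (e₁ ∨ false) ≡ (i ∧ a₁) ∧ e₁
  edge-from-A₁ false a₁    a₂    v₁    v₂    e₁    _  _  _  _  = refl
  edge-from-A₁ true  true  a₂    v₁    v₂    false _  _  _  _  = refl
  edge-from-A₁ true  false a₂    v₁    v₂    false _  _  _  _  = refl
  edge-from-A₁ true  true  a₂    v₁    v₂    true  _  _  _  _  = refl
  edge-from-A₁ true  false false v₁    v₂    true  () _  _  _
  edge-from-A₁ true  false true  v₁    false true  _  () _  _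
  edge-from-A₁ true  false true  true  true  true  _  _  () _
  edge-from-A₁ true  false true  false true  true  _  _  _  ()

covered-outside : ∀ {n} (T : Fin n → Bool) R W u → T u ≡ false → covered T R W u ≡ true
covered-outside T R W u u∉T rewrite u∉T = refl

true≢false : ∀ {a} {A : Set a} → true ≡ false → A
true≢false ()

covered-∪ : ∀ {n} {K K₁ K₂ : Graph n} → IsDisjointUnion K K₁ K₂ → ∀ {A₁ A₂ : Fin n → Bool} →
  (∀ u → A₁ u ∧ not (V K₁ u) ≡ false) → (∀ u → A₂ u ∧ not (V K₂ u) ≡ false) →
  ∀ W → T (inside (λ u → A₁ u ∨ A₂ u) W) → ∀ u →
  covered (V K) (E K) W u ≡ covered (V K₁) (E K₁) (W ∩ᵖ A₁) u ∧ covered (V K₂) (E K₂) (W ∩ᵖ A₂) u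
covered-∪ {K = K} {K₁} {K₂} U {A₁} {A₂} A₁⊆K₁ A₂⊆K₂ W W⊆A u = by-membership (V K₁ u) (V K₂ u) refl refl
  where
  c₁ c₂ : Bool
  c₁ = covered (V K₁) (E K₁) (W ∩ᵖ A₁) u
  c₂ = covered (V K₂) (E K₂) (W ∩ᵖ A₂) u
  W⊆A′ : T (inside (λ u → A₂ u ∨ A₁ u) W)
  W⊆A′ = subst T (allᶠ-cong (λ w → cong (not (lookup W w) ∨_) (∨-comm (A₁ w) (A₂ w)))) W⊆A
  by-membership : ∀ b₁ b₂ → V K₁ u ≡ b₁ → V K₂ u ≡ b₂ → covered (V K) (E K) W u ≡ c₁ ∧ c₂
  by-membership true  true  u∈K₁ u∈K₂ = true≢false (trans (sym (cong₂ _∧_ u∈K₁ u∈K₂)) (∪-disjoint U u))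
  by-membership true  false u∈K₁ u∉K₂ =
    trans (covered-part U A₂⊆K₂ W W⊆A u u∉K₂)
          (sym (trans (cong (c₁ ∧_) (covered-outside (V K₂) (E K₂) (W ∩ᵖ A₂) u u∉K₂)) (∧-identityʳ c₁)))
  by-membership false true  u∉K₁ u∈K₂ =
    trans (covered-part (∪-swap U) A₁⊆K₁ W W⊆A′ u u∉K₁)
          (sym (cong (_∧ c₂) (covered-outside (V K₁) (E K₁) (W ∩ᵖ A₁) u u∉K₁)))
  by-membership false false u∉K₁ u∉K₂ =
    trans (covered-outside (V K) (E K) W u (trans (∪-vertices U u) (cong₂ _∨_ u∉K₁ u∉K₂)))
          (sym (cong₂ _∧_ (covered-outside (V K₁) (E K₁) (W ∩ᵖ A₁) u u∉K₁)
                          (covered-outside (V K₂) (E K₂) (W ∩ᵖ A₂) u u∉K₂)))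

domPoly-∪ : ∀ {n} {K K₁ K₂ : Graph n} → IsDisjointUnion K K₁ K₂ → ∀ {A₁ A₂ : Fin n → Bool} →
  (∀ u → A₁ u ∧ not (V K₁ u) ≡ false) → (∀ u → A₂ u ∧ not (V K₂ u) ≡ false) → ∀ x →
  domPoly K (λ u → A₁ u ∨ A₂ u) x ≡ domPoly K₁ A₁ x * domPoly K₂ A₂ x
domPoly-∪ {K = K} {K₁} {K₂} U {A₁} {A₂} A₁⊆K₁ A₂⊆K₂ x = sym (begin
    domPoly K₁ A₁ x * domPoly K₂ A₂ x
      ≡⟨ cong₂ _*_ (∑-cong (λ W → ind-∧ (inside A₁ W) (covers₁ W) (x ^ ∣ W ∣)))
                   (∑-cong (λ W → ind-∧ (inside A₂ W) (covers₂ W) (x ^ ∣ W ∣))) ⟩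
    ∑ (λ W → ind (inside A₁ W) (f₁ W)) * ∑ (λ W → ind (inside A₂ W) (f₂ W))
      ≡⟨ ∑-product A₁ A₂ A₁∩A₂=∅ f₁ f₂ ⟩
    ∑ (λ W → ind (inside A W) (f₁ (W ∩ᵖ A₁) * f₂ (W ∩ᵖ A₂)))
      ≡⟨ ∑-cong (λ W → trans (ind-guard (inside A W) (glue W)) (sym (ind-∧ (inside A W) (covers W) (x ^ ∣ W ∣)))) ⟩
    domPoly K A x  ∎)
  where
  open ≡-Reasoning
  A : Fin _ → Bool
  A u = A₁ u ∨ A₂ u
  covers covers₁ covers₂ : Subset _ → Bool
  covers  W = allᶠ (covered (V K) (E K) W)
  covers₁ W = allᶠ (covered (V K₁) (E K₁) W)
  covers₂ W = allᶠ (covered (V K₂) (E K₂) W)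
  f₁ f₂ : Subset _ → ℚ
  f₁ W = ind (covers₁ W) (x ^ ∣ W ∣)
  f₂ W = ind (covers₂ W) (x ^ ∣ W ∣)
  A₁∩A₂=∅ : ∀ u → A₁ u ∧ A₂ u ≡ false
  A₁∩A₂=∅ u with A₁ u in u∈A₁ | A₂ u in u∈A₂
  ... | false | _     = refl
  ... | true  | false = refl
  ... | true  | true  =
    true≢false (trans (sym (cong₂ _∧_ (u∈K u∈A₁ (A₁⊆K₁ u)) (u∈K u∈A₂ (A₂⊆K₂ u)))) (∪-disjoint U u))
    where
    u∈K : ∀ {a b} → a ≡ true → a ∧ not b ≡ false → b ≡ true
    u∈K {b = true}  _    _ = refl
    u∈K {b = false} refl ()
  glue : ∀ W → T (inside A W) → f₁ (W ∩ᵖ A₁) * f₂ (W ∩ᵖ A₂) ≡ ind (covers W) (x ^ ∣ W ∣)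
  glue W W⊆A = sym (begin
      ind (covers W) (x ^ ∣ W ∣)
        ≡⟨ cong₂ ind (trans (allᶠ-cong (covered-∪ U A₁⊆K₁ A₂⊆K₂ W W⊆A))
                            (allᶠ-∧ (covered (V K₁) (E K₁) (W ∩ᵖ A₁)) (covered (V K₂) (E K₂) (W ∩ᵖ A₂))))
                     (trans (cong (x ^_) (∣∩ᵖ∣-split A₁ A₂ W A₁∩A₂=∅ W⊆A)) (^-+ x ∣ W ∩ᵖ A₁ ∣ ∣ W ∩ᵖ A₂ ∣)) ⟩
      ind (covers₁ (W ∩ᵖ A₁) ∧ covers₂ (W ∩ᵖ A₂)) (x ^ ∣ W ∩ᵖ A₁ ∣ * x ^ ∣ W ∩ᵖ A₂ ∣)
        ≡⟨ ind-∧-* (covers₁ (W ∩ᵖ A₁)) (covers₂ (W ∩ᵖ A₂)) (x ^ ∣ W ∩ᵖ A₁ ∣) (x ^ ∣ W ∩ᵖ A₂ ∣) ⟩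
      f₁ (W ∩ᵖ A₁) * f₂ (W ∩ᵖ A₂)  ∎)

domPoly-cong : ∀ {n} (K : Graph n) {A A′ : Fin n → Bool} → (∀ u → A u ≡ A′ u) → ∀ x → domPoly K A x ≡ domPoly K A′ x
domPoly-cong K A≡A′ x =
  ∑-cong (λ W → cong (λ b → ind (b ∧ allᶠ (covered (V K) (E K) W)) (x ^ ∣ W ∣))
                     (allᶠ-cong (λ u → cong (not (lookup W u) ∨_) (A≡A′ u))))

D-domPoly : ∀ {n} (H : Graph n) x → D H x ≡ domPoly H (V H) x
D-domPoly H x = trans (D-∑ H x) (∑-cong (λ W → cong (λ b → ind b (x ^ ∣ W ∣)) (isDomSet-char H W)))

P-domPoly : ∀ {n} (H : Graph n) v x → P H v x ≡ domPoly (delete H v) (V (deleteN H v)) x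
P-domPoly H v x = ∑-cong (λ W → cong (λ b → ind b (x ^ ∣ W ∣))
  (cong₂ _∧_ (within-char (deleteN H v) W) (dominating-char (delete H v) W)))

D-∪ : ∀ {n} {K K₁ K₂ : Graph n} → IsDisjointUnion K K₁ K₂ → ∀ x → D K x ≡ D K₁ x * D K₂ x
D-∪ {K = K} {K₁} {K₂} U x = begin
    D K x                                               ≡⟨ D-domPoly K x ⟩
    domPoly K (V K) x                                   ≡⟨ domPoly-cong K (∪-vertices U) x ⟩
    domPoly K (λ u → V K₁ u ∨ V K₂ u) x
      ≡⟨ domPoly-∪ U (λ u → ∧-inverseʳ (V K₁ u)) (λ u → ∧-inverseʳ (V K₂ u)) x ⟩
    domPoly K₁ (V K₁) x * domPoly K₂ (V K₂) x           ≡⟨ sym (cong₂ _*_ (D-domPoly K₁ x) (D-domPoly K₂ x)) ⟩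
    D K₁ x * D K₂ x                                     ∎
  where open ≡-Reasoning

_⊖_ : ∀ {n} → Graph n → (Fin n → Bool) → Graph n
H ⊖ X = record { V = λ u → V H u ∧ not (X u) ; adj = adj H ; sym = adj-sym H ; irr = irr H }

E-⊖ : ∀ {n} (H : Graph n) (X : Fin n → Bool) w u → E (H ⊖ X) w u ≡ (not (X w) ∧ not (X u)) ∧ E H w u
E-⊖ H X w u = rearrange (V H w) (not (X w)) (V H u) (not (X u)) (adj H w u)
  where
  rearrange : ∀ a b c d e → (a ∧ b) ∧ ((c ∧ d) ∧ e) ≡ (b ∧ d) ∧ (a ∧ (c ∧ e))
  rearrange = solve-∨∧ 5 (λ a b c d e → (a :* b) :* ((c :* d) :* e) := (b :* d) :* (a :* (c :* e))) refl

⊖-splitting : ∀ {n} {G G¹ G² : Graph n} {v : Fin n} → IsSplitting G G¹ G² v →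
  (X X₁ X₂ : Fin n → Bool) → X₁ v ≡ true →
  (∀ u → V G¹ u ≡ true → X u ≡ X₁ u) → (∀ u → V G² u ≡ true → X u ≡ X₂ u) →
  IsDisjointUnion (G ⊖ X) (G¹ ⊖ X₁) (G² ⊖ X₂)
⊖-splitting {G = G} {G¹} {G²} {v} S X X₁ X₂ v∈X₁ X≡X₁ X≡X₂ = record
  { ∪-vertices = λ u → trans (cong (_∧ not (X u)) (vert-union u))
                             (trans (∧-distribʳ-∨ (not (X u)) (V G¹ u) (V G² u))
                                    (cong₂ _∨_ (on-side G¹ X₁ X≡X₁ u) (on-side G² X₂ X≡X₂ u)))
  ; ∪-edges    = λ w u → begin
      E (G ⊖ X) w u                                           ≡⟨ E-⊖ G X w u ⟩
      (not (X w) ∧ not (X u)) ∧ E G w u                       ≡⟨ cong ((not (X w) ∧ not (X u)) ∧_) (edge-union w u) ⟩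
      (not (X w) ∧ not (X u)) ∧ (E G¹ w u ∨ E G² w u)         ≡⟨ ∧-distribˡ-∨ (not (X w) ∧ not (X u)) (E G¹ w u) (E G² w u) ⟩
      ((not (X w) ∧ not (X u)) ∧ E G¹ w u) ∨ ((not (X w) ∧ not (X u)) ∧ E G² w u)
        ≡⟨ cong₂ _∨_ (edge-side G¹ X₁ X≡X₁ w u) (edge-side G² X₂ X≡X₂ w u) ⟩
      E (G¹ ⊖ X₁) w u ∨ E (G² ⊖ X₂) w u                       ∎
  ; ∪-disjoint = disjoint }
  where
  open ≡-Reasoning
  open IsSplitting S
  on-side : ∀ Gⁱ Xᵢ → (∀ u → V Gⁱ u ≡ true → X u ≡ Xᵢ u) →
    ∀ u → V Gⁱ u ∧ not (X u) ≡ V Gⁱ u ∧ not (Xᵢ u)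
  on-side Gⁱ Xᵢ X≡Xᵢ u with V Gⁱ u in u∈Gⁱ
  ... | true  = cong not (X≡Xᵢ u u∈Gⁱ)
  ... | false = refl
  edge-side : ∀ Gⁱ Xᵢ → (∀ u → V Gⁱ u ≡ true → X u ≡ Xᵢ u) → ∀ w u →
    (not (X w) ∧ not (X u)) ∧ E Gⁱ w u ≡ E (Gⁱ ⊖ Xᵢ) w u
  edge-side Gⁱ Xᵢ X≡Xᵢ w u = trans (by-edge (E Gⁱ w u) refl) (sym (E-⊖ Gⁱ Xᵢ w u))
    where
    by-edge : ∀ e → E Gⁱ w u ≡ e → (not (X w) ∧ not (X u)) ∧ e ≡ (not (Xᵢ w) ∧ not (Xᵢ u)) ∧ e
    by-edge false _  = trans (∧-zeroʳ _) (sym (∧-zeroʳ _))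
    by-edge true  wu = cong (_∧ true) (cong₂ (λ a b → not a ∧ not b)
      (X≡Xᵢ w (⊆-true (E-source Gⁱ w u) wu)) (X≡Xᵢ u (⊆-true (E-endpoint Gⁱ w u) wu)))
  disjoint : ∀ u → V (G¹ ⊖ X₁) u ∧ V (G² ⊖ X₂) u ≡ false
  disjoint u with V G¹ u in u∈G¹ | V G² u in u∈G²
  ... | false | _     = refl
  ... | true  | false = ∧-zeroʳ (not (X₁ u))
  ... | true  | true  rewrite ==⇒≡ (trans (sym (vert-inter u)) (cong₂ _∧_ u∈G¹ u∈G²)) | v∈X₁ = refl

module AtArticulation {n} {G G¹ G² : Graph n} {v : Fin n} (S : IsSplitting G G¹ G² v) where
  open IsSplitting S

  v∈G¹ : V G¹ v ≡ true
  v∈G¹ = ∧-true₁ (trans (vert-inter v) (==-refl v))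

  v∈G² : V G² v ≡ true
  v∈G² = ∧-true₂ (trans (vert-inter v) (==-refl v))

  v∈G : V G v ≡ true
  v∈G = trans (vert-union v) (cong (_∨ V G² v) v∈G¹)

  delete-∪ : IsDisjointUnion (delete G v) (delete G¹ v) (delete G² v)
  delete-∪ = ⊖-splitting S (_== v) (_== v) (_== v) (==-refl v) (λ _ _ → refl) (λ _ _ → refl)

  -- G − N[v] is the disjoint union of G¹ − N[v] and G² − N[v]: on the side of Gⁱ, the closed
  -- neighbourhood of v in G is that in Gⁱ, since the sides only share v.
  deleteN-∪ : IsDisjointUnion (deleteN G v) (deleteN G¹ v) (deleteN G² v)
  deleteN-∪ = ⊖-splitting S N[v] N¹[v] N²[v] (cong (_∨ E G¹ v v) (==-refl v))
    (λ u u∈G¹ → trans (cong ((u == v) ∨_) (edge-union v u))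
                      (only-own-side (u == v) (E G¹ v u) (E G² v u) (V G² u)
                         (trans (cong (_∧ V G² u) (sym u∈G¹)) (vert-inter u)) (E-endpoint G² v u)))
    (λ u u∈G² → trans (cong ((u == v) ∨_) (trans (edge-union v u) (∨-comm (E G¹ v u) (E G² v u))))
                      (only-own-side (u == v) (E G² v u) (E G¹ v u) (V G¹ u)
                         (trans (trans (sym (∧-identityʳ (V G¹ u))) (cong (V G¹ u ∧_) (sym u∈G²))) (vert-inter u))
                         (E-endpoint G¹ v u)))
    where
    N[v] N¹[v] N²[v] : Fin n → Bool
    N[v]  u = (u == v) ∨ E G v u
    N¹[v] u = (u == v) ∨ E G¹ v u
    N²[v] u = (u == v) ∨ E G² v u
    -- a vertex of one side lies on the other side only if it is v
    only-own-side : ∀ i e e′ b′ → b′ ≡ i → e′ ∧ not b′ ≡ false → i ∨ (e ∨ e′) ≡ i ∨ e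
    only-own-side true  e e′    b′    _  _  = refl
    only-own-side false e false false _  _  = ∨-identityʳ e
    only-own-side false e true  false _  ()

  N⊆delete : ∀ (H : Graph n) u → V (deleteN H v) u ∧ not (V (delete H v) u) ≡ false
  N⊆delete H u with V H u | u == v
  ... | false | _     = refl
  ... | true  | true  = refl
  ... | true  | false = ∧-zeroʳ _

  P-∪ : ∀ x → P G v x ≡ P G¹ v x * P G² v x
  P-∪ x = begin
      P G v x                                                          ≡⟨ P-domPoly G v x ⟩
      domPoly (delete G v) (V (deleteN G v)) x                         ≡⟨ domPoly-cong (delete G v) (∪-vertices deleteN-∪) x ⟩
      domPoly (delete G v) (λ u → V (deleteN G¹ v) u ∨ V (deleteN G² v) u) x
        ≡⟨ domPoly-∪ delete-∪ (N⊆delete G¹) (N⊆delete G²) x ⟩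
      domPoly (delete G¹ v) (V (deleteN G¹ v)) x * domPoly (delete G² v) (V (deleteN G² v)) x
        ≡⟨ sym (cong₂ _*_ (P-domPoly G¹ v x) (P-domPoly G² v x)) ⟩
      P G¹ v x * P G² v x                                              ∎
    where open ≡-Reasoning

-- The final computation: solve the recurrence at G for D(G), and express the correction
-- (1 + x) p_v(G) = (1 + x) p_v(G¹) p_v(G²) as 1/(1 + x) times the product of the corrections
-- (1 + x) p_v(Gⁱ) given by the recurrences at G¹ and G².
splitting-algebra : ∀ (x i : ℚ) {DG CG d₁ d₂ m₁ m₂ p₁ p₂ c₁ c₂ D₁ D₂ : ℚ} → i * (1ℚ + x) ≡ 1ℚ →
  DG + (1ℚ + x) * (p₁ * p₂) ≡ x * CG + d₁ * d₂ + x * (m₁ * m₂) →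
  D₁ + (1ℚ + x) * p₁ ≡ x * c₁ + d₁ + x * m₁ →
  D₂ + (1ℚ + x) * p₂ ≡ x * c₂ + d₂ + x * m₂ →
  DG ≡ x * CG + d₁ * d₂ + x * m₁ * m₂ - i * ((x * c₁ + d₁ + x * m₁ - D₁) * (x * c₂ + d₂ + x * m₂ - D₂))
splitting-algebra x i {DG} {CG} {d₁} {d₂} {m₁} {m₂} {p₁} {p₂} {c₁} {c₂} {D₁} {D₂} i-inverse rec-G rec-G¹ rec-G²
  rewrite sym rec-G¹ | sym rec-G² = sym (begin
    x * CG + d₁ * d₂ + x * m₁ * m₂ - i * ((D₁ + (1ℚ + x) * p₁ - D₁) * (D₂ + (1ℚ + x) * p₂ - D₂))
      ≡⟨ factor x i CG d₁ d₂ m₁ m₂ p₁ p₂ D₁ D₂ ⟩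
    (x * CG + d₁ * d₂ + x * (m₁ * m₂)) - (i * (1ℚ + x)) * ((1ℚ + x) * (p₁ * p₂))
      ≡⟨ cong₂ (λ a b → a - b * ((1ℚ + x) * (p₁ * p₂))) (sym rec-G) i-inverse ⟩
    (DG + (1ℚ + x) * (p₁ * p₂)) - 1ℚ * ((1ℚ + x) * (p₁ * p₂))
      ≡⟨ cancel DG x p₁ p₂ ⟩
    DG  ∎)
  where
  open ≡-Reasoning
  factor : ∀ x i CG d₁ d₂ m₁ m₂ p₁ p₂ D₁ D₂ →
    x * CG + d₁ * d₂ + x * m₁ * m₂ - i * ((D₁ + (1ℚ + x) * p₁ - D₁) * (D₂ + (1ℚ + x) * p₂ - D₂))
      ≡ (x * CG + d₁ * d₂ + x * (m₁ * m₂)) - (i * (1ℚ + x)) * ((1ℚ + x) * (p₁ * p₂))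
  factor = solve-∀ ℚ-ring
  cancel : ∀ DG x p₁ p₂ → (DG + (1ℚ + x) * (p₁ * p₂)) - 1ℚ * ((1ℚ + x) * (p₁ * p₂)) ≡ DG
  cancel = solve-∀ ℚ-ring

mainTheorem10 : ∀ {n} (G G¹ G² : Graph n) (v : Fin n) → IsSplitting G G¹ G² v →
    (x : ℚ) → .{{_ : NonZero (1ℚ + x)}} →
    D G x ≡
      x * D (contract G v) x
      + D (delete G¹ v) x * D (delete G² v) x
      + x * D (deleteN G¹ v) x * D (deleteN G² v) x
      - (1/ (1ℚ + x)) *
        ((x * D (contract G¹ v) x + D (delete G¹ v) x + x * D (deleteN G¹ v) x - D G¹ x)
         * (x * D (contract G² v) x + D (delete G² v) x + x * D (deleteN G² v) x - D G² x))
mainTheorem10 G G¹ G² v S x =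
  splitting-algebra x (1/ (1ℚ + x)) (*-inverseˡ (1ℚ + x))
    recurrence-at-G (vertex-recurrence G¹ v v∈G¹ x) (vertex-recurrence G² v v∈G² x)
  where
  open AtArticulation S
  recurrence-at-G : D G x + (1ℚ + x) * (P G¹ v x * P G² v x)
                      ≡ x * D (contract G v) x + D (delete G¹ v) x * D (delete G² v) x
                        + x * (D (deleteN G¹ v) x * D (deleteN G² v) x)
  recurrence-at-G = begin
      D G x + (1ℚ + x) * (P G¹ v x * P G² v x)
        ≡⟨ cong (λ p → D G x + (1ℚ + x) * p) (sym (P-∪ x)) ⟩
      D G x + (1ℚ + x) * P G v x
        ≡⟨ vertex-recurrence G v v∈G x ⟩
      x * D (contract G v) x + D (delete G v) x + x * D (deleteN G v) x
        ≡⟨ cong₂ (λ d m → x * D (contract G v) x + d + x * m) (D-∪ delete-∪ x) (D-∪ deleteN-∪ x) ⟩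
      x * D (contract G v) x + D (delete G¹ v) x * D (delete G² v) x
        + x * (D (deleteN G¹ v) x * D (deleteN G² v) x)  ∎
    where open ≡-Reasoning
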